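{- Every type $\mathbf t$ (over a subset of a structure $M$) that has an $h$-axiomatization is 2-$h$-maximal.
   Context: Types are consistent sets of formulas in one free variable $x$ with parameters from $M$ (consistency and implication are modulo the theory of $M$ with parameters). An $h$-axiomatization of $\mathbf t$ is a disjoint pair $\mathbf t_A,\mathbf t_B$ of sets of formulas with parameters, every formula of $\mathbf t_A$ an $h$-formula and every formula of $\mathbf t_B$ the negation of an $h$-formula, such that $\mathbf t_A\sqcup\mathbf t_B$ axiomatizes $\mathbf t$. Here $h$-formulas form the smallest class containing atomic formulas and closed under $\varphi\wedge\psi$, $\exists x\varphi$, $\forall x\varphi$, $\exists x\varphi\wedge\forall x(\varphi\rightarrow\psi)$. Let $B_{\mathbf t}$ be the set of $h$-formulas $\psi(x,\bar y)$ with $\neg\psi(x,\bar b)\in\mathbf t_B$ for some $\bar b$. For an $h$-formula $\psi(x,\bar y)$ put $E_\psi(x,x')=\exists\bar y\,\psi(x,\bar y)\wedge\forall\bar y(\psi(x,\bar y)\rightarrow\psi(x',\bar y))$. For $n\ge1$ and finite $B_0\subseteq B_{\mathbf t}$, $\mathbf t[B_0,n]$ is the set of formulas in variables $x_0,\dots,x_{n-1}$ consisting of $\mathbf t_A(x_i)$ for $i<n$ together with $\neg E_\psi(x_i,x_j)$ for $\psi\in B_0$, $i<j<n$. The type $\mathbf t$ is 2-$h$-maximal if it has an $h$-axiomatization $\mathbf t_A\sqcup\mathbf t_B$ for which $\mathbf t[\{\psi\},2]$ is consistent for every $\psi\in B_{\mathbf t}$. -}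

module Defs where

open import Level using (0ℓ)
open import Data.Nat using (ℕ; zero; suc)
open import Data.Fin using (Fin; zero; suc; _<_)
open import Data.Vec using (Vec; []; _∷_)
open import Data.Vec.Functional using (Vector) renaming (_∷_ to _∷ᶠ_)
open import Data.List using (List)
open import Data.List.Relation.Unary.All using (All)
open import Data.Product using (Σ; Σ-syntax; _×_; _,_)
open import Data.Sum using (_⊎_)
open import Data.Empty using (⊥)
open import Data.Unit using (⊤)
open import Relation.Nullary using (¬_)
open import Relation.Binary.PropositionalEquality using (_≡_)

record Language : Set₁ where
  field
    Func     : Set
    funArity : Func → ℕ
    Rel      : Set
    relArity : Rel → ℕ

module _ (L : Language) where
  open Language L

  record Structure : Set₁ where
    field
      Carrier : Set
      funᴹ    : (f : Func) → Vec Carrier (funArity f) → Carrier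
      relᴹ    : (R : Rel) → Vec Carrier (relArity R) → Set

  data Term (P : Set) (n : ℕ) : Set where
    var : Fin n → Term P n
    par : P → Term P n
    app : (f : Func) → Vec (Term P n) (funArity f) → Term P n

  -- Formulas with n free (de Bruijn) variables and parameters from P;
  -- quantifiers bind variable zero.
  data Formula (P : Set) : ℕ → Set where
    rel  : ∀ {n} (R : Rel) → Vec (Term P n) (relArity R) → Formula P n
    _≐_  : ∀ {n} → Term P n → Term P n → Formula P n
    ⊥'   : ∀ {n} → Formula P n
    ¬'_  : ∀ {n} → Formula P n → Formula P n
    _∧'_ : ∀ {n} → Formula P n → Formula P n → Formula P n
    _∨'_ : ∀ {n} → Formula P n → Formula P n → Formula P n
    _⇒'_ : ∀ {n} → Formula P n → Formula P n → Formula P n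
    ∃'_  : ∀ {n} → Formula P (suc n) → Formula P n
    ∀'_  : ∀ {n} → Formula P (suc n) → Formula P n

  data HForm {P : Set} : ∀ {n} → Formula P n → Set where
    h-rel : ∀ {n} R (ts : Vec (Term P n) (relArity R)) → HForm (rel R ts)
    h-eq  : ∀ {n} (s t : Term P n) → HForm (s ≐ t)
    h-∧   : ∀ {n} {φ ψ : Formula P n} → HForm φ → HForm ψ → HForm (φ ∧' ψ)
    h-∃   : ∀ {n} {φ : Formula P (suc n)} → HForm φ → HForm (∃' φ)
    h-∀   : ∀ {n} {φ : Formula P (suc n)} → HForm φ → HForm (∀' φ)
    h-∃∀  : ∀ {n} {φ ψ : Formula P (suc n)} → HForm φ → HForm ψ →
            HForm ((∃' φ) ∧' (∀' (φ ⇒' ψ)))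

  mutual
    renTerm : ∀ {P m n} → (Fin m → Fin n) → Term P m → Term P n
    renTerm ρ (var i)    = var (ρ i)
    renTerm ρ (par p)    = par p
    renTerm ρ (app f ts) = app f (renTerms ρ ts)

    renTerms : ∀ {P m n k} → (Fin m → Fin n) → Vec (Term P m) k → Vec (Term P n) k
    renTerms ρ []       = []
    renTerms ρ (t ∷ ts) = renTerm ρ t ∷ renTerms ρ ts

  mutual
    substTerm : ∀ {P m n} → (Fin m → Term P n) → Term P m → Term P n
    substTerm σ (var i)    = σ i
    substTerm σ (par p)    = par p
    substTerm σ (app f ts) = app f (substTerms σ ts)

    substTerms : ∀ {P m n k} → (Fin m → Term P n) → Vec (Term P m) k → Vec (Term P n) k
    substTerms σ []       = []
    substTerms σ (t ∷ ts) = substTerm σ t ∷ substTerms σ ts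

  liftSub : ∀ {P m n} → (Fin m → Term P n) → Fin (suc m) → Term P (suc n)
  liftSub σ zero    = var zero
  liftSub σ (suc i) = renTerm suc (σ i)

  subst : ∀ {P m n} → (Fin m → Term P n) → Formula P m → Formula P n
  subst σ (rel R ts) = rel R (substTerms σ ts)
  subst σ (s ≐ t)    = substTerm σ s ≐ substTerm σ t
  subst σ ⊥'         = ⊥'
  subst σ (¬' φ)     = ¬' subst σ φ
  subst σ (φ ∧' ψ)   = subst σ φ ∧' subst σ ψ
  subst σ (φ ∨' ψ)   = subst σ φ ∨' subst σ ψ
  subst σ (φ ⇒' ψ)   = subst σ φ ⇒' subst σ ψ
  subst σ (∃' φ)     = ∃' subst (liftSub σ) φ
  subst σ (∀' φ)     = ∀' subst (liftSub σ) φ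

  -- ψ(x, b̄): replace y_i (variable suc i) by the parameter b i, keep x
  instantiate : ∀ {P k} → Formula P (suc k) → (Fin k → P) → Formula P 1
  instantiate ψ b = subst σ ψ
    where
    σ : Fin _ → Term _ 1
    σ zero    = var zero
    σ (suc i) = par (b i)

  module Semantics (M : Structure) where
    open Structure M

    mutual
      evalTerm : ∀ {n} → (Fin n → Carrier) → Term Carrier n → Carrier
      evalTerm e (var i)    = e i
      evalTerm e (par p)    = p
      evalTerm e (app f ts) = funᴹ f (evalTerms e ts)

      evalTerms : ∀ {n k} → (Fin n → Carrier) → Vec (Term Carrier n) k → Vec Carrier k
      evalTerms e []       = []
      evalTerms e (t ∷ ts) = evalTerm e t ∷ evalTerms e ts

    ⟦_⟧ : ∀ {n} → Formula Carrier n → (Fin n → Carrier) → Set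
    ⟦ rel R ts ⟧ e = relᴹ R (evalTerms e ts)
    ⟦ s ≐ t ⟧    e = evalTerm e s ≡ evalTerm e t
    ⟦ ⊥' ⟧       e = ⊥
    ⟦ ¬' φ ⟧     e = ¬ ⟦ φ ⟧ e
    ⟦ φ ∧' ψ ⟧   e = ⟦ φ ⟧ e × ⟦ ψ ⟧ e
    ⟦ φ ∨' ψ ⟧   e = ⟦ φ ⟧ e ⊎ ⟦ ψ ⟧ e
    ⟦ φ ⇒' ψ ⟧   e = ⟦ φ ⟧ e → ⟦ ψ ⟧ e
    ⟦ ∃' φ ⟧     e = Σ[ a ∈ Carrier ] ⟦ φ ⟧ (a ∷ᶠ e)
    ⟦ ∀' φ ⟧     e = (a : Carrier) → ⟦ φ ⟧ (a ∷ᶠ e)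

    Formula₁ : Set
    Formula₁ = Formula Carrier 1

    Sat₁ : Formula₁ → Carrier → Set
    Sat₁ φ a = ⟦ φ ⟧ (λ _ → a)

    FSet : Set₁
    FSet = Formula₁ → Set

    _∪_ : FSet → FSet → FSet
    (S ∪ T) φ = S φ ⊎ T φ

    -- consistency modulo Th(M_M) = finite satisfiability in M
    Consistent : FSet → Set
    Consistent S = (Δ : List Formula₁) → All S Δ →
                   Σ[ a ∈ Carrier ] All (λ δ → Sat₁ δ a) Δ

    -- implication modulo Th(M_M): some finite part of S implies φ in M
    Implies : FSet → Formula₁ → Set
    Implies S φ = Σ[ Δ ∈ List Formula₁ ] All S Δ ×
                  ((a : Carrier) → All (λ δ → Sat₁ δ a) Δ → Sat₁ φ a)

    IsType : FSet → Set
    IsType t = Consistent t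

    Axiomatizes : FSet → FSet → Set
    Axiomatizes S t = ((φ : Formula₁) → t φ → Implies S φ) ×
                      ((φ : Formula₁) → S φ → Implies t φ)

    record HAxiomatization (t : FSet) : Set₁ where
      field
        tA tB    : FSet
        tA-h     : (φ : Formula₁) → tA φ → HForm φ
        tB-negh  : (φ : Formula₁) → tB φ → Σ[ θ ∈ Formula₁ ] HForm θ × (φ ≡ (¬' θ))
        disjoint : (φ : Formula₁) → tA φ → tB φ → ⊥
        axiom    : Axiomatizes (tA ∪ tB) t

    -- h-formula ψ(x,ȳ) with ȳ of length k; variable zero is x
    HFormula : Set
    HFormula = Σ[ k ∈ ℕ ] Formula Carrier (suc k)

    module _ {t : FSet} (ax : HAxiomatization t) where
      open HAxiomatization ax

      InB : HFormula → Set
      InB (k , ψ) = HForm ψ × Σ[ b ∈ (Fin k → Carrier) ] tB (¬' instantiate ψ b)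

      -- M ⊨ E_ψ(a, a') where
      -- E_ψ(x,x') = ∃ȳ ψ(x,ȳ) ∧ ∀ȳ (ψ(x,ȳ) → ψ(x',ȳ))
      E : HFormula → Carrier → Carrier → Set
      E (k , ψ) a a' = (Σ[ b ∈ (Fin k → Carrier) ] ⟦ ψ ⟧ (a ∷ᶠ b)) ×
                       ((b : Fin k → Carrier) → ⟦ ψ ⟧ (a ∷ᶠ b) → ⟦ ψ ⟧ (a' ∷ᶠ b))

      -- consistency (= finite satisfiability in M) of t[B₀,n]:
      -- t_A(x_i) for i < n, and ¬E_ψ(x_i,x_j) for ψ ∈ B₀, i < j < n
      ConsistentT : List HFormula → ℕ → Set
      ConsistentT B₀ n =
        (Δ : List Formula₁) → All tA Δ →
        Σ[ a ∈ (Fin n → Carrier) ]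
          ((i : Fin n) → All (λ δ → Sat₁ δ (a i)) Δ) ×
          All (λ ψ → (i j : Fin n) → i < j → ¬ E ψ (a i) (a j)) B₀

    Two-h-maximal : FSet → Set₁
    Two-h-maximal t = Σ[ ax ∈ HAxiomatization t ]
      ((ψ : HFormula) → InB ax ψ → ConsistentT ax (ψ Data.List.∷ Data.List.[]) 2)

-- Drop from t_B every formula already implied by t_A; this still axiomatizes t.
-- If then ¬ψ(x,b̄) ∈ t_B and Δ ⊆ t_A is finite, Δ ∧ ψ(x,b̄) is satisfiable (otherwise
-- t_A would imply ¬ψ(x,b̄)), say by a, while Δ ∧ ¬ψ(x,b̄) is satisfiable by consistency
-- of t, say by a'. Then E_ψ(a,a') fails at b̄, so (a, a') realises t[{ψ},2] on Δ.
module Submission where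

open import Defs
open import Level using (0ℓ)
open import Axiom.ExcludedMiddle using (ExcludedMiddle)
open import Data.Nat using (ℕ; suc; s≤s)
open import Data.Fin using (Fin; zero; suc; _<_)
open import Data.Vec using (Vec; []; _∷_)
open import Data.Vec.Functional using () renaming (_∷_ to _∷ᶠ_)
open import Data.List using (List; []; _∷_; _++_)
open import Data.List.Relation.Unary.All using (All; []; _∷_) renaming (map to All-map)
open import Data.List.Relation.Unary.All.Properties using (++⁺; ++⁻ˡ; ++⁻ʳ)
open import Data.Product using (Σ-syntax; _×_; _,_; proj₁; proj₂)
import Data.Product.Function.Dependent.Propositional as Σ
open import Data.Product.Function.NonDependent.Propositional using (_×-⇔_)
open import Data.Sum using ([_,_]; inj₁; inj₂)
open import Data.Sum.Function.Propositional using (_⊎-⇔_)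
open import Function using (_∘_)
open import Function.Bundles using (_⇔_; mk⇔; Equivalence)
open import Function.Construct.Identity using (⇔-id)
open import Function.Related.TypeIsomorphisms using (→-cong-⇔; ¬-cong-⇔)
open import Relation.Nullary using (¬_; yes; no)
open import Relation.Nullary.Decidable using (decidable-stable)
open import Relation.Unary using (_⊆_)
open import Relation.Binary.PropositionalEquality using (_≡_; refl; trans; cong; cong₂)

module Substitution (L : Language) (M : Structure L) where
  open Structure M
  open Semantics L M

  private
    variable
      m n k : ℕ
      ρ     : Fin m → Fin n
      σ     : Fin m → Term L Carrier n
      e     : Fin n → Carrier
      e'    : Fin m → Carrier

  mutual
    evalTerm-renTerm : (∀ i → e (ρ i) ≡ e' i) → (t : Term L Carrier m) →
                       evalTerm e (renTerm L ρ t) ≡ evalTerm e' t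
    evalTerm-renTerm h (var i)    = h i
    evalTerm-renTerm h (par p)    = refl
    evalTerm-renTerm h (app f ts) = cong (funᴹ f) (evalTerms-renTerms h ts)

    evalTerms-renTerms : (∀ i → e (ρ i) ≡ e' i) → (ts : Vec (Term L Carrier m) k) →
                         evalTerms e (renTerms L ρ ts) ≡ evalTerms e' ts
    evalTerms-renTerms h []       = refl
    evalTerms-renTerms h (t ∷ ts) = cong₂ _∷_ (evalTerm-renTerm h t) (evalTerms-renTerms h ts)

  mutual
    evalTerm-substTerm : (∀ i → evalTerm e (σ i) ≡ e' i) → (t : Term L Carrier m) →
                         evalTerm e (substTerm L σ t) ≡ evalTerm e' t
    evalTerm-substTerm h (var i)    = h i
    evalTerm-substTerm h (par p)    = refl
    evalTerm-substTerm h (app f ts) = cong (funᴹ f) (evalTerms-substTerms h ts)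

    evalTerms-substTerms : (∀ i → evalTerm e (σ i) ≡ e' i) → (ts : Vec (Term L Carrier m) k) →
                           evalTerms e (substTerms L σ ts) ≡ evalTerms e' ts
    evalTerms-substTerms h []       = refl
    evalTerms-substTerms h (t ∷ ts) = cong₂ _∷_ (evalTerm-substTerm h t) (evalTerms-substTerms h ts)

  evalTerm-liftSub : (∀ i → evalTerm e (σ i) ≡ e' i) → (c : Carrier) →
                     ∀ i → evalTerm (c ∷ᶠ e) (liftSub L σ i) ≡ (c ∷ᶠ e') i
  evalTerm-liftSub         h c zero    = refl
  evalTerm-liftSub {σ = σ} h c (suc i) =
    trans (evalTerm-renTerm {ρ = suc} (λ _ → refl) (σ i)) (h i)

  ≡⇒⇔ : {A B : Set} → A ≡ B → A ⇔ B
  ≡⇒⇔ refl = ⇔-id _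

  ⟦subst⟧⇔ : (∀ i → evalTerm e (σ i) ≡ e' i) → (φ : Formula L Carrier m) →
             ⟦ subst L σ φ ⟧ e ⇔ ⟦ φ ⟧ e'
  ⟦subst⟧⇔ h (rel R ts) = ≡⇒⇔ (cong (relᴹ R) (evalTerms-substTerms h ts))
  ⟦subst⟧⇔ h (s ≐ t)    =
    ≡⇒⇔ (cong₂ _≡_ (evalTerm-substTerm h s) (evalTerm-substTerm h t))
  ⟦subst⟧⇔ h ⊥'         = ⇔-id _
  ⟦subst⟧⇔ h (¬' φ)     = ¬-cong-⇔ (⟦subst⟧⇔ h φ)
  ⟦subst⟧⇔ h (φ ∧' ψ)   = ⟦subst⟧⇔ h φ ×-⇔ ⟦subst⟧⇔ h ψ
  ⟦subst⟧⇔ h (φ ∨' ψ)   = ⟦subst⟧⇔ h φ ⊎-⇔ ⟦subst⟧⇔ h ψ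
  ⟦subst⟧⇔ h (φ ⇒' ψ)   = →-cong-⇔ (⟦subst⟧⇔ h φ) (⟦subst⟧⇔ h ψ)
  ⟦subst⟧⇔ h (∃' φ)     = Σ.congˡ λ {c} → ⟦subst⟧⇔ (evalTerm-liftSub h c) φ
  ⟦subst⟧⇔ h (∀' φ)     =
    mk⇔ (λ f c → Equivalence.to   (⟦subst⟧⇔ (evalTerm-liftSub h c) φ) (f c))
        (λ f c → Equivalence.from (⟦subst⟧⇔ (evalTerm-liftSub h c) φ) (f c))

  Sat₁-instantiate⇔ : ∀ {k} (ψ : Formula L Carrier (suc k)) (b : Fin k → Carrier) (a : Carrier) →
                      Sat₁ (instantiate L ψ b) a ⇔ ⟦ ψ ⟧ (a ∷ᶠ b)
  Sat₁-instantiate⇔ ψ b a = ⟦subst⟧⇔ (λ { zero → refl ; (suc i) → refl }) ψ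

module Entailment (L : Language) (M : Structure L) where
  open Structure M
  open Semantics L M
  open Substitution L M using (Sat₁-instantiate⇔)

  SatAll : List Formula₁ → Carrier → Set
  SatAll Δ a = All (λ δ → Sat₁ δ a) Δ

  Satisfiable : List Formula₁ → Set
  Satisfiable Δ = Σ[ a ∈ Carrier ] SatAll Δ a

  Implies-refl : ∀ {S : FSet} {φ} → S φ → Implies S φ
  Implies-refl {φ = φ} s = φ ∷ [] , s ∷ [] , λ { a (h ∷ []) → h }

  Implies-mono : ∀ {S T : FSet} {φ} → S ⊆ T → Implies S φ → Implies T φ
  Implies-mono S⊆T (Γ , Γ⊆S , Γ⇒φ) = Γ , All-map S⊆T Γ⊆S , Γ⇒φ

  Implies-All : ∀ {S T : FSet} {Δ} → (∀ {φ} → T φ → Implies S φ) → All T Δ →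
                Σ[ Γ ∈ List Formula₁ ] All S Γ × (∀ a → SatAll Γ a → SatAll Δ a)
  Implies-All S⇒T []       = [] , [] , λ _ _ → []
  Implies-All S⇒T (δ ∷ Δ) with S⇒T δ | Implies-All S⇒T Δ
  ... | Γ₁ , Γ₁⊆S , Γ₁⇒δ | Γ₂ , Γ₂⊆S , Γ₂⇒Δ =
    Γ₁ ++ Γ₂ , ++⁺ Γ₁⊆S Γ₂⊆S , λ a h → Γ₁⇒δ a (++⁻ˡ Γ₁ h) ∷ Γ₂⇒Δ a (++⁻ʳ Γ₁ h)

  Implies-trans : ∀ {S T : FSet} {φ} → (∀ {ψ} → T ψ → Implies S ψ) → Implies T φ → Implies S φ
  Implies-trans S⇒T (Δ , Δ⊆T , Δ⇒φ) with Implies-All S⇒T Δ⊆T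
  ... | Γ , Γ⊆S , Γ⇒Δ = Γ , Γ⊆S , λ a h → Δ⇒φ a (Γ⇒Δ a h)

  Consistent-Implies : ∀ {S T : FSet} → Consistent S → (∀ {φ} → T φ → Implies S φ) →
                       Consistent T
  Consistent-Implies S-consistent S⇒T Δ Δ⊆T with Implies-All S⇒T Δ⊆T
  ... | Γ , Γ⊆S , Γ⇒Δ with S-consistent Γ Γ⊆S
  ... | a , a⊨Γ = a , Γ⇒Δ a a⊨Γ

  ¬Implies-¬⇒Satisfiable : ExcludedMiddle 0ℓ → ∀ {S : FSet} {θ Δ} →
                           ¬ Implies S (¬' θ) → All S Δ → Satisfiable (θ ∷ Δ)
  ¬Implies-¬⇒Satisfiable em {Δ = Δ} ¬S⇒¬θ Δ⊆S =
    decidable-stable em λ unsat → ¬S⇒¬θ (Δ , Δ⊆S , λ a a⊨Δ a⊨θ → unsat (a , a⊨θ ∷ a⊨Δ))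

  module _ {t : FSet} where

    prune : ExcludedMiddle 0ℓ → HAxiomatization t → HAxiomatization t
    prune em ax = record
      { tA       = tA
      ; tB       = tB-unimplied
      ; tA-h     = tA-h
      ; tB-negh  = λ φ → tB-negh φ ∘ proj₁
      ; disjoint = λ φ φ∈tA → disjoint φ φ∈tA ∘ proj₁
      ; axiom    = (λ φ φ∈t → Implies-trans {φ = φ} tA∪tB⇒pruned (proj₁ axiom φ φ∈t))
                 , (λ φ → proj₂ axiom φ ∘ [ inj₁ , inj₂ ∘ proj₁ ])
      }
      where
      open HAxiomatization ax

      tB-unimplied : FSet
      tB-unimplied φ = tB φ × ¬ Implies tA φ

      tA∪tB⇒pruned : ∀ {φ} → (tA ∪ tB) φ → Implies (tA ∪ tB-unimplied) φ
      tA∪tB⇒pruned {φ} (inj₁ φ∈tA) = Implies-refl {φ = φ} (inj₁ φ∈tA)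
      tA∪tB⇒pruned {φ} (inj₂ φ∈tB) with em {Implies tA φ}
      ... | yes tA⇒φ  = Implies-mono {φ = φ} inj₁ tA⇒φ
      ... | no  tA⇏φ = Implies-refl {φ = φ} (inj₂ (φ∈tB , tA⇏φ))

    module _ (ax : HAxiomatization t) where

      instance-separates⇒¬E : ∀ {k} (ψ : Formula L Carrier (suc k)) (b : Fin k → Carrier)
                              {a a' : Carrier} →
                              Sat₁ (instantiate L ψ b) a → ¬ Sat₁ (instantiate L ψ b) a' →
                              ¬ E ax (k , ψ) a a'
      instance-separates⇒¬E ψ b {a} {a'} a⊨ψb a'⊭ψb (_ , ψ-transfers) =
        a'⊭ψb (Equivalence.from (Sat₁-instantiate⇔ ψ b a')
                 (ψ-transfers b (Equivalence.to (Sat₁-instantiate⇔ ψ b a) a⊨ψb)))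

      pair-realises : ∀ {ψ : HFormula} {Δ : List Formula₁} {a a' : Carrier} →
                      SatAll Δ a → SatAll Δ a' → ¬ E ax ψ a a' →
                      Σ[ v ∈ (Fin 2 → Carrier) ] ((i : Fin 2) → SatAll Δ (v i)) ×
                        All (λ χ → (i j : Fin 2) → i < j → ¬ E ax χ (v i) (v j)) (ψ ∷ [])
      pair-realises {ψ} {Δ} {a} {a'} a⊨Δ a'⊨Δ ¬E-aa' = v , v⊨Δ , separated ∷ []
        where
        v : Fin 2 → Carrier
        v = a ∷ᶠ λ _ → a'

        v⊨Δ : (i : Fin 2) → SatAll Δ (v i)
        v⊨Δ zero       = a⊨Δ
        v⊨Δ (suc zero) = a'⊨Δ

        separated : (i j : Fin 2) → i < j → ¬ E ax ψ (v i) (v j)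
        separated zero       (suc zero) _ = ¬E-aa'
        separated zero       zero       ()
        separated (suc zero) zero       ()
        separated (suc zero) (suc zero) (s≤s ())

lemma6p5 : ExcludedMiddle 0ℓ →
    (L : Language) (M : Structure L) (t : Semantics.FSet L M) →
    Semantics.IsType L M t → Semantics.HAxiomatization L M t →
    Semantics.Two-h-maximal L M t
lemma6p5 em L M t t-consistent ax = prune em ax , two-points
  where
  open Semantics L M
  open HAxiomatization ax
  open Entailment L M

  tA∪tB-consistent : Consistent (tA ∪ tB)
  tA∪tB-consistent = Consistent-Implies t-consistent λ {φ} → proj₂ axiom φ

  two-points : (ψ : HFormula) → InB (prune em ax) ψ → ConsistentT (prune em ax) (ψ ∷ []) 2
  two-points (k , ψ) (_ , b , ¬ψb∈tB , tA⇏¬ψb) Δ Δ⊆tA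
    with ¬Implies-¬⇒Satisfiable em {θ = instantiate L ψ b} tA⇏¬ψb Δ⊆tA
       | tA∪tB-consistent (¬' instantiate L ψ b ∷ Δ) (inj₂ ¬ψb∈tB ∷ All-map inj₁ Δ⊆tA)
  ... | a , a⊨ψb ∷ a⊨Δ | a' , a'⊭ψb ∷ a'⊨Δ =
    pair-realises (prune em ax) a⊨Δ a'⊨Δ
      (instance-separates⇒¬E (prune em ax) ψ b a⊨ψb a'⊭ψb)
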